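{- For any finite set $\mathit{AP}$ of atomic propositions, subset $I \subseteq \mathit{AP}$, and bound $k \in \mathbb{N}$, there is a deterministic finite automaton $\mathcal{A}_k$ over the alphabet $\Sigma = 2^{\mathit{AP}}$ with $(2^{|I|}+1)^k \cdot (k+1)^k$ states such that $L(\mathcal{A}_k) = \{ w \in \Sigma^* \mid \exists \sigma \in L_k^I(\Sigma^\omega).\ w \text{ is a prefix of } \sigma\}$.
   Context: For $\sigma \in \Sigma^\omega$, $\sigma|_I \in (2^I)^\omega$ is its projection onto $I$. $L_k^I(\Sigma^\omega)$ is the set of all $\sigma \in \Sigma^\omega$ for which there exist finite words $u \in (2^I)^*$ and $v \in (2^I)^+$ with $|u \cdot v| = k$ and $\sigma|_I = u \cdot v^\omega$. A deterministic finite automaton has a single initial state, a total transition function $\delta : Q \times \Sigma \to Q$ and a set of accepting states; $L(\mathcal{A}_k)$ is the set of finite words it accepts. -}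

module Defs where

open import Data.Nat using (ℕ; zero; suc; _+_; _*_; _^_; _<_)
open import Data.Nat.DivMod using (_mod_)
open import Data.Fin using (Fin)
open import Data.Fin.Subset using (Subset; _∩_; ∣_∣)
open import Data.Bool using (Bool; true)
open import Data.List using (List; []; _∷_; length; lookup)
open import Data.List.NonEmpty using (List⁺; _∷_) renaming (length to length⁺)
open import Data.Product using (Σ; Σ-syntax; _×_; ∃-syntax)
open import Relation.Binary.PropositionalEquality using (_≡_)
open import Function.Bundles using (_⇔_)

-- Atomic propositions AP = Fin n; the alphabet Σ = 2^AP = Subset n.
Letter : ℕ → Set
Letter n = Subset n

ωWord : ℕ → Set
ωWord n = ℕ → Letter n

Word : ℕ → Set
Word n = List (Letter n)

-- Projection σ|_I: each letter a ⊆ AP is mapped to a ∩ I ∈ 2^I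
-- (letters of 2^I are represented as subsets of AP contained in I).
proj : ∀ {n} → Subset n → ωWord n → ωWord n
proj I σ i = σ i ∩ I

cyc : ∀ {A : Set} → List⁺ A → ℕ → A
cyc (a ∷ as) i = lookup (a ∷ as) (i mod suc (length as))

lasso : ∀ {A : Set} → List A → List⁺ A → ℕ → A
lasso []      v i       = cyc v i
lasso (x ∷ u) v zero    = x
lasso (x ∷ u) v (suc i) = lasso u v i

InLk : ∀ {n} → Subset n → ℕ → ωWord n → Set
InLk {n} I k σ =
  Σ[ u ∈ List (Letter n) ] Σ[ v ∈ List⁺ (Letter n) ]
    ((length u + length⁺ v ≡ k) × (∀ i → proj I σ i ≡ lasso u v i))

IsPrefix : ∀ {n} → Word n → ωWord n → Set
IsPrefix w σ = ∀ (i : Fin (length w)) → lookup w i ≡ σ (Data.Fin.toℕ i)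

record DFA (A : Set) (m : ℕ) : Set where
  field
    init : Fin m
    δ    : Fin m → A → Fin m
    acc  : Fin m → Bool

  run : Fin m → List A → Fin m
  run q []      = q
  run q (a ∷ w) = run (δ q a) w

  Accepts : List A → Set
  Accepts w = acc (run init w) ≡ true

PrefLk : ∀ {n} → Subset n → ℕ → Word n → Set
PrefLk {n} I k w = ∃[ σ ] (InLk I k σ × IsPrefix w σ)

numStates : ∀ {n} → Subset n → ℕ → ℕ
numStates I k = (2 ^ ∣ I ∣ + 1) ^ k * (k + 1) ^ k

-- A finite word w is a prefix of some σ ∈ L_k^I iff its projection w|_I has a period
-- p ∈ [1, k] on the positions [k, |w|). A lasso u · v^ω with |u · v| = k has period |v| from
-- position k on; conversely, splitting the first k projected letters as u · v with |v| = p,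
-- that period forces w|_I to agree with u · v^ω, and σ continues w by u · v^ω.
-- The automaton keeps the last k projected letters (each in 2^I or blank) and one bit per
-- candidate period, which survives as long as every new letter from position k on equals
-- the letter p positions back.

module Submission where

open import Defs
open import Data.Bool using (Bool; true; false; T; not; _∧_; _∨_)
open import Data.Bool.Properties using (T-≡; T-∧; T?; _≟_; ∧-identityʳ; ∧-zeroʳ)
open import Data.Fin using (Fin; zero; suc; toℕ; fromℕ<; _↑ʳ_)
open import Data.Fin.Properties
  using (2↔Bool; 1↔⊤; +↔⊎; *↔×; toℕ-fromℕ<; toℕ-injective; toℕ<n; any?)
open import Data.Fin.Subset using (Subset; _∩_; ∣_∣) renaming (⊥ to ∅)
open import Data.Fin.Subset.Properties using (∩-assoc; ∩-idem)
open import Data.Maybe using (Maybe; just; nothing; maybe; is-just)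
import Data.Maybe.Properties as Maybe
open import Data.Nat using (ℕ; zero; suc; _+_; _*_; _^_; _∸_; _≤_; _<_; _≤ᵇ_; z≤n; s≤s)
open import Data.Nat.DivMod using (_%_; _mod_; m<n⇒m%n≡m; [m+n]%n≡m%n)
open import Data.Nat.Induction using (<-rec)
open import Data.Nat.Properties
  using (_<?_; ≤-pred; ≤-trans; <-trans; ≤-<-trans; <-≤-trans; n≤1+n; n<1+n; m<n⇒m<1+n;
         m≤n⇒m<n∨m≡n; ≮⇒≥; ≤ᵇ-reflects-≤; m≤n+m; +-assoc; +-suc; +-identityʳ;
         ∸-monoʳ-<; m∸n≤m; m∸n+n≡m; m+[n∸m]≡n; m+n≤o⇒m≤o∸n; m<n+o⇒m∸n<o)
open import Data.Product using (_×_; _,_; Σ-syntax; ∃-syntax; uncurry)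
open import Data.Product.Function.Dependent.Propositional using (Σ-⇔)
open import Data.Product.Function.NonDependent.Propositional using (_×-↪_; _×-⇔_)
open import Data.Sum using (_⊎_; inj₁; inj₂; [_,_])
open import Data.Sum.Function.Propositional using (_⊎-↪_)
open import Data.List
  using (List; []; _∷_; length; lookup; map; applyUpTo; applyDownFrom; _ʳ++_)
open import Data.List.Properties
  using (length-applyUpTo; lookup-applyUpTo; length-applyDownFrom)
open import Data.List.Membership.Propositional.Properties using (∈-lookup)
open import Data.List.NonEmpty using (List⁺; _∷_; toList) renaming (length to length⁺)
open import Data.List.Relation.Unary.All as All using (All; []; _∷_)
open import Data.List.Relation.Unary.All.Properties using (applyUpTo⁺₂)
open import Data.Unit using (⊤; tt)
open import Data.Vec using (Vec; []; _∷_; truncate)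
import Data.Vec as Vec
open import Data.Vec.Properties
  using (map-∘; map-cong; map-id; tabulate-cong; lookup∘tabulate; ∷-injective; ∷-injectiveʳ; ≡-dec)
open import Data.Vec.Recursive using (Fin[m^n]↔Fin[m]^n)
open import Data.Vec.Recursive.Properties using (↔Vec)
open import Function using (const; _∘_)
open import Function.Bundles
  using (_⇔_; _↔_; _↪_; mk⇔; mk↔ₛ′; mk↪; Equivalence; RightInverse)
open import Function.Construct.Composition using (_↪-∘_)
open import Function.Construct.Identity using (↠-id; ⇔-id)
open import Function.Construct.Symmetry using (⇔-sym)
open import Function.Properties.Equivalence using () renaming (trans to ⇔-trans)
open import Function.Properties.Inverse using (↔-sym; ↔-trans; ↔⇒↪)
open import Relation.Binary.PropositionalEquality
  using (_≡_; refl; sym; trans; cong; cong₂; subst; module ≡-Reasoning)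
open import Relation.Binary.Definitions using (DecidableEquality)
open import Relation.Nullary using (yes; no; does; ⌊_⌋; contradiction)
open import Relation.Nullary.Decidable using (toWitness; fromWitness)
open import Relation.Nullary.Reflects using (ofʸ; ofⁿ)

infixr 5 _++ω_

_++ω_ : ∀ {A : Set} → List A → (ℕ → A) → ℕ → A
([]      ++ω f) i       = f i
((x ∷ u) ++ω f) zero    = x
((x ∷ u) ++ω f) (suc i) = (u ++ω f) i

module _ {A : Set} where

  ++ω-length : ∀ (u : List A) f j → (u ++ω f) (length u + j) ≡ f j
  ++ω-length []      f j = refl
  ++ω-length (x ∷ u) f j = ++ω-length u f j

  ++ω-prefix : ∀ (u : List A) f (j : Fin (length u)) → lookup u j ≡ (u ++ω f) (toℕ j)
  ++ω-prefix (x ∷ u) f zero    = refl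
  ++ω-prefix (x ∷ u) f (suc j) = ++ω-prefix u f j

  prefix-agree : ∀ (w : List A) (σ σ′ : ℕ → A) →
                 (∀ j → lookup w j ≡ σ (toℕ j)) → (∀ j → lookup w j ≡ σ′ (toℕ j)) →
                 ∀ {i} → i < length w → σ i ≡ σ′ i
  prefix-agree w σ σ′ pw pw′ i<m = begin
    σ _                                 ≡⟨ cong σ (toℕ-fromℕ< i<m) ⟨
    σ (toℕ (fromℕ< i<m))                ≡⟨ trans (sym (pw _)) (pw′ _) ⟩
    σ′ (toℕ (fromℕ< i<m))               ≡⟨ cong σ′ (toℕ-fromℕ< i<m) ⟩
    σ′ _                                ∎
    where open ≡-Reasoning

PeriodicOn : ∀ {A : Set} → ℕ → ℕ → ℕ → (ℕ → A) → Set
PeriodicOn p k m f = ∀ i → k ≤ i → i < m → f i ≡ f (i ∸ p)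

module _ {A : Set} {p k : ℕ} where

  PeriodicOn-suc : ∀ {m} {f : ℕ → A} →
                   PeriodicOn p k (suc m) f ⇔ (PeriodicOn p k m f × (k ≤ m → f m ≡ f (m ∸ p)))
  PeriodicOn-suc {m} {f} = mk⇔
    (λ per → (λ i k≤i i<m → per i k≤i (m<n⇒m<1+n i<m)) , (λ k≤m → per m k≤m (n<1+n m)))
    extend
    where
    extend : PeriodicOn p k m f × (k ≤ m → f m ≡ f (m ∸ p)) → PeriodicOn p k (suc m) f
    extend (per , last) i k≤i i<1+m with m≤n⇒m<n∨m≡n (≤-pred i<1+m)
    ... | inj₁ i<m  = per i k≤i i<m
    ... | inj₂ refl = last k≤i

  PeriodicOn-kernel : ∀ {B C : Set} {g : A → B} {h : A → C} {m} {σ : ℕ → A} →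
                      (∀ x y → g x ≡ g y ⇔ h x ≡ h y) →
                      PeriodicOn p k m (g ∘ σ) ⇔ PeriodicOn p k m (h ∘ σ)
  PeriodicOn-kernel same = mk⇔
    (λ per i k≤i i<m → Equivalence.to (same _ _) (per i k≤i i<m))
    (λ per i k≤i i<m → Equivalence.from (same _ _) (per i k≤i i<m))

  periodic-agree : ∀ {m} {f g : ℕ → A} → 0 < p → p ≤ k → (∀ i → i < k → f i ≡ g i) →
                   PeriodicOn p k m f → PeriodicOn p k m g → ∀ i → i < m → f i ≡ g i
  periodic-agree {m} {f} {g} 0<p p≤k below perf perg = <-rec (λ i → i < m → f i ≡ g i) agree
    where
    agree : ∀ i → (∀ {j} → j < i → j < m → f j ≡ g j) → i < m → f i ≡ g i
    agree i earlier i<m with i <? k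
    ... | yes i<k = below i i<k
    ... | no  i≮k = begin
      f i        ≡⟨ perf i k≤i i<m ⟩
      f (i ∸ p)  ≡⟨ earlier i∸p<i (<-trans i∸p<i i<m) ⟩
      g (i ∸ p)  ≡⟨ perg i k≤i i<m ⟨
      g i        ∎
      where
      open ≡-Reasoning
      k≤i = ≮⇒≥ i≮k
      i∸p<i = ∸-monoʳ-< 0<p (≤-trans p≤k k≤i)

module _ {A : Set} where

  cyc-mod : ∀ (v : List⁺ A) j (i : Fin (length⁺ v)) → toℕ i ≡ j % length⁺ v →
            cyc v j ≡ lookup (toList v) i
  cyc-mod (a ∷ as) j i i≡j%p =
    cong (lookup (a ∷ as)) (toℕ-injective (trans (toℕ-fromℕ< _) (sym i≡j%p)))

  cyc-lookup : ∀ (v : List⁺ A) {j} (j<p : j < length⁺ v) →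
               cyc v j ≡ lookup (toList v) (fromℕ< j<p)
  cyc-lookup v {j} j<p = cyc-mod v j _ (trans (toℕ-fromℕ< j<p) (sym (m<n⇒m%n≡m j<p)))

  cyc-periodic : ∀ (v : List⁺ A) j → cyc v (j + length⁺ v) ≡ cyc v j
  cyc-periodic v@(_ ∷ _) j =
    cyc-mod v (j + length⁺ v) (j mod length⁺ v) (trans (toℕ-fromℕ< _) (sym ([m+n]%n≡m%n j _)))

  lasso-++ω : ∀ (u : List A) v i → lasso u v i ≡ (u ++ω cyc v) i
  lasso-++ω []      v i       = refl
  lasso-++ω (x ∷ u) v zero    = refl
  lasso-++ω (x ∷ u) v (suc i) = lasso-++ω u v i

  lasso-cyc : ∀ (u : List A) v j → lasso u v (length u + j) ≡ cyc v j
  lasso-cyc u v j = trans (lasso-++ω u v _) (++ω-length u (cyc v) j)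

  lasso-periodic : ∀ (u : List A) v i → length u + length⁺ v ≤ i →
                   lasso u v i ≡ lasso u v (i ∸ length⁺ v)
  lasso-periodic u v i |uv|≤i = begin
    lasso u v i                      ≡⟨ cong (lasso u v) (m∸n+n≡m p≤i) ⟨
    lasso u v (i ∸ p + p)            ≡⟨ cong (λ x → lasso u v (x + p)) u+t≡i∸p ⟨
    lasso u v (length u + t + p)     ≡⟨ cong (lasso u v) (+-assoc (length u) t p) ⟩
    lasso u v (length u + (t + p))   ≡⟨ lasso-cyc u v (t + p) ⟩
    cyc v (t + p)                    ≡⟨ cyc-periodic v t ⟩
    cyc v t                          ≡⟨ lasso-cyc u v t ⟨
    lasso u v (length u + t)         ≡⟨ cong (lasso u v) u+t≡i∸p ⟩
    lasso u v (i ∸ p)                ∎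
    where
    open ≡-Reasoning
    p = length⁺ v
    t = i ∸ p ∸ length u
    p≤i = ≤-trans (m≤n+m p (length u)) |uv|≤i
    u+t≡i∸p = m+[n∸m]≡n (m+n≤o⇒m≤o∸n (length u) |uv|≤i)

  lasso-All : ∀ {P : A → Set} (u : List A) v → All P u → All P (toList v) → ∀ i → P (lasso u v i)
  lasso-All {P} u v@(_ ∷ _) Pu Pv i = subst P (sym (lasso-++ω u v i)) (++ω-All u Pu i)
    where
    ++ω-All : ∀ u → All P u → ∀ i → P ((u ++ω cyc v) i)
    ++ω-All []       []         i       = All.lookup Pv (∈-lookup (i mod length⁺ v))
    ++ω-All (x ∷ u) (Px ∷ Pu)   zero    = Px
    ++ω-All (x ∷ u) (Px ∷ Pu)   (suc i) = ++ω-All u Pu i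

applyUpTo⁺ : ∀ {A : Set} → (ℕ → A) → ℕ → List⁺ A
applyUpTo⁺ f t = f 0 ∷ applyUpTo (f ∘ suc) t

module _ {A : Set} where

  ++ω-applyUpTo : ∀ (g : ℕ → A) f {a i} → i < a → (applyUpTo g a ++ω f) i ≡ g i
  ++ω-applyUpTo g f {suc a} {zero}  _         = refl
  ++ω-applyUpTo g f {suc a} {suc i} (s≤s i<a) = ++ω-applyUpTo (g ∘ suc) f i<a

  lasso-applyUpTo : ∀ (g : ℕ → A) a t {i} → i < a + suc t →
                    lasso (applyUpTo g a) (applyUpTo⁺ (λ j → g (a + j)) t) i ≡ g i
  lasso-applyUpTo g a t {i} i<a+p with i <? a
  ... | yes i<a =
    trans (lasso-++ω (applyUpTo g a) (applyUpTo⁺ (λ j → g (a + j)) t) i) (++ω-applyUpTo g _ i<a)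
  ... | no  i≮a = begin
    lasso u v i                        ≡⟨ cong (lasso u v) |u|+j≡i ⟨
    lasso u v (length u + j)           ≡⟨ lasso-cyc u v j ⟩
    cyc v j                            ≡⟨ cyc-lookup v j<p ⟩
    lookup (toList v) (fromℕ< j<p)     ≡⟨ lookup-applyUpTo (λ j → g (a + j)) (suc t) _ ⟩
    g (a + toℕ (fromℕ< j<p))           ≡⟨ cong (λ x → g (a + x)) (toℕ-fromℕ< j<p) ⟩
    g (a + j)                          ≡⟨ cong g a+j≡i ⟩
    g i                                ∎
    where
    open ≡-Reasoning
    u = applyUpTo g a
    v = applyUpTo⁺ (λ j → g (a + j)) t
    j = i ∸ a
    a+j≡i = m+[n∸m]≡n (≮⇒≥ i≮a)
    |u|+j≡i = trans (cong (_+ j) (length-applyUpTo g a)) a+j≡i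
    j<p : j < length⁺ v
    j<p = subst (j <_) (cong suc (sym (length-applyUpTo _ t))) (m<n+o⇒m∸n<o i a i<a+p)

  -- The witnesses u · v are the first k values of g, split so that |v| = suc t.
  periodic⇒lasso : ∀ {g : ℕ → A} {k m} t → suc t ≤ k → PeriodicOn (suc t) k m g →
                   Σ[ u ∈ List A ] Σ[ v ∈ List⁺ A ]
                     (length u + length⁺ v ≡ k) × (∀ i → i < m → g i ≡ lasso u v i) ×
                     (∀ i → ∃[ j ] lasso u v i ≡ g j)
  periodic⇒lasso {g} {k} {m} t p≤k perg = u , v , |uv|≡k , agree , values
    where
    a = k ∸ suc t
    u = applyUpTo g a
    v = applyUpTo⁺ (λ j → g (a + j)) t
    a+p≡k : a + suc t ≡ k
    a+p≡k = m∸n+n≡m p≤k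
    |v|≡p : length⁺ v ≡ suc t
    |v|≡p = cong suc (length-applyUpTo _ t)
    |uv|≡k = trans (cong₂ _+_ (length-applyUpTo g a) |v|≡p) a+p≡k
    per-lasso : PeriodicOn (suc t) k m (lasso u v)
    per-lasso i k≤i _ = subst (λ p → lasso u v i ≡ lasso u v (i ∸ p)) |v|≡p
                     (lasso-periodic u v i (subst (_≤ i) (sym |uv|≡k) k≤i))
    agree = periodic-agree (s≤s z≤n) p≤k
              (λ i i<k → sym (lasso-applyUpTo g a t (subst (i <_) (sym a+p≡k) i<k))) perg per-lasso
    values : ∀ i → ∃[ j ] lasso u v i ≡ g j
    values = lasso-All {P = λ x → ∃[ j ] x ≡ g j} u v
               (applyUpTo⁺₂ g a (λ j → j , refl))
               (applyUpTo⁺₂ (λ j → g (a + j)) (suc t) (λ j → a + j , refl))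

module _ {n : ℕ} (I : Subset n) (k : ℕ) where

  prefLk⇒periodic : ∀ (w : Word n) {σ₀} → IsPrefix w σ₀ → PrefLk I k w →
                    ∃[ q ] PeriodicOn (suc (toℕ q)) k (length w) (proj I σ₀)
  prefLk⇒periodic w {σ₀} pσ₀ (σ , (u , v@(_ ∷ as) , |uv|≡k , σ≡lasso) , pσ) =
    fromℕ< t<k , subst (λ p → PeriodicOn p k (length w) (proj I σ₀))
                       (cong suc (sym (toℕ-fromℕ< t<k))) per
    where
    t<k : length as < k
    t<k = subst (length⁺ v ≤_) |uv|≡k (m≤n+m (length⁺ v) (length u))
    agree : ∀ {i} → i < length w → proj I σ₀ i ≡ lasso u v i
    agree i<m = trans (cong (_∩ I) (prefix-agree w σ₀ σ pσ₀ pσ i<m)) (σ≡lasso _)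
    per : PeriodicOn (length⁺ v) k (length w) (proj I σ₀)
    per i k≤i i<m = begin
      proj I σ₀ i                ≡⟨ agree i<m ⟩
      lasso u v i                ≡⟨ lasso-periodic u v i (subst (_≤ i) (sym |uv|≡k) k≤i) ⟩
      lasso u v (i ∸ length⁺ v)  ≡⟨ agree (≤-<-trans (m∸n≤m i (length⁺ v)) i<m) ⟨
      proj I σ₀ (i ∸ length⁺ v)  ∎
      where open ≡-Reasoning

  periodic⇒prefLk : ∀ (w : Word n) {σ₀} → IsPrefix w σ₀ → ∀ (q : Fin k) →
                    PeriodicOn (suc (toℕ q)) k (length w) (proj I σ₀) → PrefLk I k w
  periodic⇒prefLk w {σ₀} pσ₀ q per with periodic⇒lasso (toℕ q) (toℕ<n q) per
  ... | u , v , |uv|≡k , agree , values = σ , (u , v , |uv|≡k , σ≡lasso) , ++ω-prefix w _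
    where
    m = length w
    σ = w ++ω (λ j → lasso u v (m + j))
    lasso-∩ : ∀ i → lasso u v i ∩ I ≡ lasso u v i
    lasso-∩ i with values i
    ... | j , eq = subst (λ x → x ∩ I ≡ x) (sym eq)
                         (trans (∩-assoc (σ₀ j) I I) (cong (σ₀ j ∩_) (∩-idem I)))
    σ≡lasso : ∀ i → proj I σ i ≡ lasso u v i
    σ≡lasso i with i <? m
    ... | yes i<m =
      trans (cong (_∩ I) (prefix-agree w σ σ₀ (++ω-prefix w _) pσ₀ i<m)) (agree i i<m)
    ... | no  i≮m = begin
      σ i ∩ I                ≡⟨ cong (λ x → σ x ∩ I) m+j≡i ⟨
      σ (m + j) ∩ I          ≡⟨ cong (_∩ I) (++ω-length w _ j) ⟩
      lasso u v (m + j) ∩ I  ≡⟨ cong (λ x → lasso u v x ∩ I) m+j≡i ⟩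
      lasso u v i ∩ I        ≡⟨ lasso-∩ i ⟩
      lasso u v i            ∎
      where
      open ≡-Reasoning
      j = i ∸ m
      m+j≡i = m+[n∸m]≡n (≮⇒≥ i≮m)

  prefLk⇔periodic : ∀ (w : Word n) {σ₀} → IsPrefix w σ₀ →
                    (∃[ q ] PeriodicOn (suc (toℕ q)) k (length w) (proj I σ₀)) ⇔ PrefLk I k w
  prefLk⇔periodic w pσ₀ =
    mk⇔ (λ (q , per) → periodic⇒prefLk w pσ₀ q per) (prefLk⇒periodic w pσ₀)

record Automaton (A S : Set) : Set where
  field
    start : S
    step  : S → A → S
    final : S → Bool

  run : S → List A → S
  run s []      = s
  run s (a ∷ w) = run (step s a) w

module _ {A S : Set} {m : ℕ} (e : S ↪ Fin m) (M : Automaton A S) where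
  open RightInverse e
  open Automaton M

  relabel : DFA A m
  relabel = record
    { init = to start
    ; δ    = λ i a → to (step (from i) a)
    ; acc  = λ i → final (from i)
    }

  relabel-run : ∀ s w → DFA.run relabel (to s) w ≡ to (run s w)
  relabel-run s []      = refl
  relabel-run s (a ∷ w) =
    trans (cong (λ s′ → DFA.run relabel (to (step s′ a)) w) (strictlyInverseʳ s))
          (relabel-run (step s a) w)

  relabel-accepts : ∀ w → DFA.Accepts relabel w ⇔ T (final (run start w))
  relabel-accepts w =
    subst (λ b → (b ≡ true) ⇔ T (final (run start w))) (sym final-run) (⇔-sym T-≡)
    where
    final-run : final (from (DFA.run relabel (to start) w)) ≡ final (run start w)
    final-run =
      cong final (trans (cong from (relabel-run start w)) (strictlyInverseʳ (run start w)))

Vec-↪ : ∀ {A B : Set} {n} → A ↪ B → Vec A n ↪ Vec B n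
Vec-↪ {A} {n = n} e = mk↪ from∘to
  where
  open RightInverse e
  from∘to : ∀ {xs : Vec A n} {ys} → ys ≡ Vec.map to xs → Vec.map from ys ≡ xs
  from∘to {xs} refl =
    trans (sym (map-∘ from to xs)) (trans (map-cong strictlyInverseʳ xs) (map-id xs))

Vec-Fin-↪ : ∀ {A : Set} {m n} → A ↪ Fin m → Vec A n ↪ Fin (m ^ n)
Vec-Fin-↪ {m = m} {n} e =
  ↔⇒↪ (↔-trans (↔-sym (↔Vec n)) (↔-sym (Fin[m^n]↔Fin[m]^n m n))) ↪-∘ Vec-↪ e

Maybe↔⊎⊤ : ∀ {A : Set} → Maybe A ↔ (A ⊎ ⊤)
Maybe↔⊎⊤ = mk↔ₛ′ (maybe inj₁ (inj₂ tt)) [ just , const nothing ]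
  (λ { (inj₁ x) → refl ; (inj₂ tt) → refl }) (λ { (just x) → refl ; nothing → refl })

Maybe-Fin-↪ : ∀ {A : Set} {m} → A ↪ Fin m → Maybe A ↪ Fin (m + 1)
Maybe-Fin-↪ e = ↔⇒↪ (↔-sym +↔⊎) ↪-∘ ((e ⊎-↪ ↔⇒↪ (↔-sym 1↔⊤)) ↪-∘ ↔⇒↪ Maybe↔⊎⊤)

Bool-↪ : ∀ n → Bool ↪ Fin (suc (n + 1))
Bool-↪ n = mk↪ {to = λ { false → zero ; true → suc (n ↑ʳ zero) }}
               {from = λ { zero → false ; (suc _) → true }}
               λ { {false} refl → refl ; {true} refl → refl }

-- Only 2^k of the (k+1)^k codes are used.
Vec-Bool-↪ : ∀ k → Vec Bool k ↪ Fin ((k + 1) ^ k)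
Vec-Bool-↪ zero    = mk↪ {to = const zero} {from = const []} λ { {[]} _ → refl }
Vec-Bool-↪ (suc n) = Vec-Fin-↪ (Bool-↪ n)

Bits-↪ : ∀ c → Vec Bool c ↪ Fin (2 ^ c)
Bits-↪ c = Vec-Fin-↪ (↔⇒↪ (↔-sym 2↔Bool))

module _ {A B : Set} (h : A → B) where

  ʳ++-applyDownFrom : ∀ (w : List A) (σ : ℕ → A) m → (∀ j → lookup w j ≡ σ (m + toℕ j)) →
                      map h w ʳ++ applyDownFrom (h ∘ σ) m ≡ applyDownFrom (h ∘ σ) (m + length w)
  ʳ++-applyDownFrom []      σ m pw = cong (applyDownFrom (h ∘ σ)) (sym (+-identityʳ m))
  ʳ++-applyDownFrom (a ∷ w) σ m pw = begin
    map h w ʳ++ (h a ∷ applyDownFrom (h ∘ σ) m)  ≡⟨ cong (λ x → map h w ʳ++ (h x ∷ _)) a≡σm ⟩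
    map h w ʳ++ applyDownFrom (h ∘ σ) (suc m)    ≡⟨ ʳ++-applyDownFrom w σ (suc m) pw′ ⟩
    applyDownFrom (h ∘ σ) (suc m + length w)     ≡⟨ cong (applyDownFrom _) (+-suc m (length w)) ⟨
    applyDownFrom (h ∘ σ) (m + suc (length w))   ∎
    where
    open ≡-Reasoning
    a≡σm = trans (pw zero) (cong σ (+-identityʳ m))
    pw′ : ∀ j → lookup w j ≡ σ (suc m + toℕ j)
    pw′ j = trans (pw (suc j)) (cong σ (+-suc m (toℕ j)))

module _ {R : Set} where

  recent : ∀ j → List R → Vec (Maybe R) j
  recent zero    _       = []
  recent (suc j) []      = nothing ∷ recent j []
  recent (suc j) (b ∷ z) = just b ∷ recent j z

  full : ∀ {j} → Vec (Maybe R) j → Bool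
  full []       = true
  full (x ∷ xs) = is-just x ∧ full xs

  truncate-recent : ∀ {i j} (i≤j : i ≤ j) z → truncate i≤j (recent j z) ≡ recent i z
  truncate-recent z≤n       z       = refl
  truncate-recent (s≤s i≤j) []      = cong (nothing ∷_) (truncate-recent i≤j [])
  truncate-recent (s≤s i≤j) (b ∷ z) = cong (just b ∷_) (truncate-recent i≤j z)

  full-recent : ∀ j z → full (recent j z) ≡ (j ≤ᵇ length z)
  full-recent zero          z       = refl
  full-recent (suc j)       []      = refl
  full-recent (suc zero)    (b ∷ z) = refl
  full-recent (suc (suc j)) (b ∷ z) = full-recent (suc j) z

  lookup-recent-applyDownFrom :
    ∀ {j} (g : ℕ → R) m (q : Fin j) → toℕ q < m →
    Vec.lookup (recent j (applyDownFrom g m)) q ≡ just (g (m ∸ suc (toℕ q)))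
  lookup-recent-applyDownFrom g (suc m) zero    _         = refl
  lookup-recent-applyDownFrom g (suc m) (suc q) (s≤s q<m) = lookup-recent-applyDownFrom g m q q<m

-- The state after reading a word holds its k most recent letters (under κ) and, for every
-- period p = suc q ≤ k, whether the word read so far has period p from position k on.
module PeriodAutomaton {A R : Set} (_≟_ : DecidableEquality R) (κ : A → R) (k : ℕ) where

  State : Set
  State = Vec (Maybe R) k × Vec Bool k

  consistent : Vec (Maybe R) k → R → Fin k → Bool
  consistent W b q = not (full W) ∨ does (just b ≟ₘ Vec.lookup W q)
    where _≟ₘ_ = Maybe.≡-dec _≟_

  alive : Fin k → List R → Bool
  alive q []      = true
  alive q (b ∷ z) = alive q z ∧ consistent (recent k z) b q

  state : List R → State
  state z = recent k z , Vec.tabulate (λ q → alive q z)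

  automaton : Automaton A State
  automaton = record
    { start = state []
    ; step  = λ { (W , al) a → truncate (n≤1+n k) (just (κ a) ∷ W)
                             , Vec.tabulate (λ q → Vec.lookup al q ∧ consistent W (κ a) q) }
    ; final = λ { (_ , al) → ⌊ any? (λ q → T? (Vec.lookup al q)) ⌋ }
    }

  open Automaton automaton

  step-state : ∀ z a → step (state z) a ≡ state (κ a ∷ z)
  step-state z a = cong₂ _,_
    (truncate-recent (n≤1+n k) (κ a ∷ z))
    (tabulate-cong λ q →
      cong (_∧ consistent (recent k z) (κ a) q) (lookup∘tabulate (λ q → alive q z) q))

  run-state : ∀ z w → run (state z) w ≡ state (map κ w ʳ++ z)
  run-state z []      = refl
  run-state z (a ∷ w) = trans (cong (λ s → run s w) (step-state z a)) (run-state (κ a ∷ z) w)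

  final-state : ∀ z → T (final (state z)) ⇔ (∃[ q ] T (alive q z))
  final-state z =
    mk⇔ (λ acc → alive-at (toWitness acc)) (λ (q , al) → fromWitness (q , bit-at q al))
    where
    bits = Vec.tabulate (λ q → alive q z)
    alive-at : ∃[ q ] T (Vec.lookup bits q) → ∃[ q ] T (alive q z)
    alive-at (q , bit) = q , subst T (lookup∘tabulate _ q) bit
    bit-at : ∀ q → T (alive q z) → T (Vec.lookup bits q)
    bit-at q = subst T (sym (lookup∘tabulate _ q))

  consistent-history : ∀ g m (q : Fin k) →
    T (consistent (recent k (applyDownFrom g m)) (g m) q) ⇔ (k ≤ m → g m ≡ g (m ∸ suc (toℕ q)))
  consistent-history g m q
    rewrite full-recent k (applyDownFrom g m) | length-applyDownFrom g m
    with k ≤ᵇ m | ≤ᵇ-reflects-≤ k m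
  ... | false | ofⁿ k≰m = mk⇔ (λ _ k≤m → contradiction k≤m k≰m) (const _)
  ... | true  | ofʸ k≤m
    rewrite lookup-recent-applyDownFrom g m q (<-≤-trans (toℕ<n q) k≤m)
    with g m ≟ g (m ∸ suc (toℕ q))
  ... | yes eq  = mk⇔ (const (const eq)) (const _)
  ... | no  neq = mk⇔ (λ ()) (λ per → neq (per k≤m))

  alive-history : ∀ g m (q : Fin k) →
                  T (alive q (applyDownFrom g m)) ⇔ PeriodicOn (suc (toℕ q)) k m g
  alive-history g zero    q = mk⇔ (λ _ _ _ ()) (const _)
  alive-history g (suc m) q =
    ⇔-trans T-∧ (⇔-trans (alive-history g m q ×-⇔ consistent-history g m q)
                         (⇔-sym (PeriodicOn-suc {p = suc (toℕ q)} {k})))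

  accepts⇔periodic : ∀ w {σ} → (∀ j → lookup w j ≡ σ (toℕ j)) →
    T (final (run start w)) ⇔ (∃[ q ] PeriodicOn (suc (toℕ q)) k (length w) (κ ∘ σ))
  accepts⇔periodic w {σ} pw
    rewrite run-state [] w | ʳ++-applyDownFrom κ w σ 0 pw =
    ⇔-trans (final-state (applyDownFrom (κ ∘ σ) (length w)))
            (Σ-⇔ (↠-id (Fin k)) λ {q} → alive-history (κ ∘ σ) (length w) q)

restrict : ∀ {n} (I : Subset n) → Subset n → Vec Bool ∣ I ∣
restrict []          []      = []
restrict (true  ∷ I) (x ∷ a) = x ∷ restrict I a
restrict (false ∷ I) (x ∷ a) = restrict I a

restrict-≡ : ∀ {n} (I a b : Subset n) → restrict I a ≡ restrict I b ⇔ a ∩ I ≡ b ∩ I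
restrict-≡ []          []      []      = mk⇔ (const refl) (const refl)
restrict-≡ (true  ∷ I) (x ∷ a) (y ∷ b) rewrite ∧-identityʳ x | ∧-identityʳ y =
  ⇔-trans ∷-≡ (⇔-trans (⇔-id _ ×-⇔ restrict-≡ I a b) (⇔-sym ∷-≡))
  where
  ∷-≡ : ∀ {A : Set} {m} {x y : A} {xs ys : Vec A m} → (x ∷ xs ≡ y ∷ ys) ⇔ (x ≡ y × xs ≡ ys)
  ∷-≡ = mk⇔ ∷-injective (uncurry (cong₂ _∷_))
restrict-≡ (false ∷ I) (x ∷ a) (y ∷ b) rewrite ∧-zeroʳ x | ∧-zeroʳ y =
  ⇔-trans (restrict-≡ I a b) (mk⇔ (cong (false ∷_)) ∷-injectiveʳ)

state-↪ : ∀ c k →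
          (Vec (Maybe (Vec Bool c)) k × Vec Bool k) ↪ Fin ((2 ^ c + 1) ^ k * (k + 1) ^ k)
state-↪ c k = ↔⇒↪ (↔-sym *↔×) ↪-∘ (Vec-Fin-↪ (Maybe-Fin-↪ (Bits-↪ c)) ×-↪ Vec-Bool-↪ k)

theorem2 : (n : ℕ) (I : Subset n) (k : ℕ) →
    Σ[ A ∈ DFA (Letter n) (numStates I k) ]
      (∀ (w : Word n) → DFA.Accepts A w ⇔ PrefLk I k w)
theorem2 n I k = relabel (state-↪ ∣ I ∣ k) automaton , accepts⇔prefLk
  where
  open PeriodAutomaton (≡-dec _≟_) (restrict I) k
  accepts⇔prefLk : ∀ w → DFA.Accepts (relabel (state-↪ ∣ I ∣ k) automaton) w ⇔ PrefLk I k w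
  accepts⇔prefLk w =
    ⇔-trans (relabel-accepts (state-↪ ∣ I ∣ k) automaton w)
    (⇔-trans (accepts⇔periodic w {σ₀} pw)
    (⇔-trans (Σ-⇔ (↠-id (Fin k))
                  λ {q} → PeriodicOn-kernel {p = suc (toℕ q)} {σ = σ₀} (restrict-≡ I))
             (prefLk⇔periodic I k w {σ₀} pw)))
    where
    σ₀ = w ++ω const ∅
    pw = ++ω-prefix w (const ∅)
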